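{- Let $T$ be a tree with $m$ edges, given as a left-layered tree (as defined in the context). Then $T$ has a range-relaxed graceful labeling whose vertex labels all lie in $\{0,1,\dots,m+ex(T)\}$, where $ex(T)$ is the excess of this left-layered representation.
   Context: A range-relaxed graceful labeling of a tree $T$ is an injective map $f:V(T)\to\mathbb{Z}_{\ge 0}$ such that the induced edge weights $g(uv)=|f(u)-f(v)|$ are pairwise distinct over the edges of $T$. Left-layered tree: Let $T$ have diameter $d$. Root $T$ at a vertex $r$ with $\deg(r)=1$ and $\gamma(r)=d$, where for a vertex $v$, $\gamma(v)$ is the number of levels in which $v$ has at least one descendant. Level $L_k$ is the set of vertices at distance $k$ from $r$ ($L_0=\{r\}$). Within each level vertices are linearly ordered, $u\prec v$ meaning $u$ is placed to the left of $v$, subject to: (1) siblings of degree one are ordered arbitrarily; (2) if $u,v$ are siblings with $\gamma(u)<\gamma(v)$ then $u\prec v$; (3) if $u,v$ are siblings with $\gamma(u)=\gamma(v)$ and $\deg(u)\ge\deg(v)$ then $u\prec v$; (4) if siblings satisfy $u\prec v$ and $a,b$ are descendants of $u,v$ respectively on the same level, then $a\prec b$. (So edges drawn between consecutive levels do not cross.) Excess: Write $L_j=\{v^j_1\prec v^j_2\prec\cdots\prec v^j_{n_j}\}$, $n_j=|L_j|$. If there is an index $i$ with $\mathrm{dist}(v^j_i,v^j_{i+1})>2$, let $i$ be the smallest such index, let $u$ be the parent of $v^j_i$, and set $ex_j=|\{v\in L_{j-1}: u\prec v\}|$; if there is no such index (e.g. $|L_j|=1$, or all pairs of vertices of $L_j$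 are at distance $2$), set $ex_j=0$. The excess of $T$ is $ex(T)=\sum_{j=0}^{d} ex_j$. -}

module Defs where

open import Data.Nat using (ℕ; zero; suc; _+_; _∸_; _⊔_; _≤_; _<_; _<ᵇ_; ∣_-_∣)
import Data.Nat as N
open import Data.Fin using (Fin; toℕ)
import Data.Fin as F
open import Data.List using (List; []; _∷_; [_]; length; lookup; map; concatMap; allFin; upTo)
open import Data.Nat.ListAction using (sum)
import Data.List.Properties as LP
open import Data.Maybe using (Maybe; just; nothing; maybe′)
open import Data.Bool using (Bool; true; false; if_then_else_)
open import Data.Product using (Σ; _×_; _,_)
open import Data.Empty using (⊥)
open import Data.Unit using (⊤)
open import Relation.Nullary using (yes; no; does; ¬_)
open import Relation.Binary.PropositionalEquality using (_≡_; refl)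

-- The list of children of a node
-- is its left-to-right order; levels are read off left to right, so edges
-- between consecutive levels never cross (condition (4) holds by
-- construction).

data Tree : Set where
  node : List Tree → Tree

data Pos : Tree → Set where
  root  : ∀ {ts} → Pos (node ts)
  child : ∀ {ts} (i : Fin (length ts)) → Pos (lookup ts i) → Pos (node ts)

nch : Tree → ℕ
nch (node ts) = length ts

-- γ(v) = number of levels (below v) in which v has a descendant = height
mutual
  height : Tree → ℕ
  height (node ts) = heights ts

  heights : List Tree → ℕ
  heights []       = 0
  heights (t ∷ ts) = suc (height t) ⊔ heights ts

mutual
  numEdges : Tree → ℕ
  numEdges (node ts) = numEdgesL ts

  numEdgesL : List Tree → ℕ
  numEdgesL []       = 0
  numEdgesL (t ∷ ts) = suc (numEdges t) + numEdgesL ts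

subtree : ∀ {t} → Pos t → Tree
subtree {t} root = t
subtree (child i p) = subtree p

-- γ(v) and deg(v) (deg of a non-root vertex is children + 1 for the parent)
γ : ∀ {t} → Pos t → ℕ
γ p = height (subtree p)

depth : ∀ {t} → Pos t → ℕ
depth root        = 0
depth (child i p) = suc (depth p)

dist : ∀ {t} → Pos t → Pos t → ℕ
dist root root        = 0
dist root (child j q) = suc (depth q)
dist (child i p) root = suc (depth p)
dist (child i p) (child j q) with i F.≟ j
... | yes refl = dist p q
... | no _     = suc (depth p) + suc (depth q)

-- parent (the root is sent to itself; only used for non-root vertices)
parentM : ∀ {t} → Pos t → Maybe (Pos t)
parentM root        = nothing
parentM (child i p) = just (maybe′ (child i) root (parentM p))

parent : ∀ {t} → Pos t → Pos t
parent p = maybe′ (λ x → x) p (parentM p)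

NonRoot : ∀ {t} → Pos t → Set
NonRoot root        = ⊥
NonRoot (child _ _) = ⊤

path : ∀ {t} → Pos t → List ℕ
path root        = []
path (child i p) = toℕ i ∷ path p

samePos : ∀ {t} → Pos t → Pos t → Bool
samePos p q = does (LP.≡-dec N._≟_ (path p) (path q))

level : (t : Tree) → ℕ → List (Pos t)
level (node ts) zero    = [ root ]
level (node ts) (suc k) =
  concatMap (λ i → map (child i) (level (lookup ts i) k)) (allFin (length ts))

SiblingOK : List Tree → Set
SiblingOK ts = ∀ (i j : Fin (length ts)) → i F.< j →
  (¬ (height (lookup ts j) < height (lookup ts i))) ×
  (height (lookup ts i) ≡ height (lookup ts j) →
     nch (lookup ts j) ≤ nch (lookup ts i))

data Ordered : Tree → Set where
  node : ∀ {ts} → SiblingOK ts → (∀ i → Ordered (lookup ts i)) → Ordered (node ts)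

IsDiameter : Tree → ℕ → Set
IsDiameter t d = (∀ (p q : Pos t) → dist p q ≤ d) × Σ (Pos t) (λ p → Σ (Pos t) (λ q → dist p q ≡ d))

LeftLayered : Tree → ℕ → Set
LeftLayered t d = (nch t ≡ 1) × IsDiameter t d × (height t ≡ d) × Ordered t

firstBad : ∀ {t} → List (Pos t) → Maybe (Pos t)
firstBad []            = nothing
firstBad (x ∷ [])      = nothing
firstBad (x ∷ y ∷ xs)  = if 2 <ᵇ dist x y then just x else firstBad (y ∷ xs)

countRight : ∀ {t} → Pos t → List (Pos t) → ℕ
countRight u []       = 0
countRight u (w ∷ ws) = if samePos u w then length ws else countRight u ws

exLevel : (t : Tree) → ℕ → ℕ
exLevel t j =
  maybe′ (λ v → countRight (parent v) (level t (j ∸ 1))) 0 (firstBad (level t j))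

excess : Tree → ℕ → ℕ
excess t d = sum (map (exLevel t) (upTo (suc d)))

weight : ∀ {t} → (Pos t → ℕ) → Pos t → ℕ
weight f p = ∣ f p - f (parent p) ∣

IsRRGraceful : (t : Tree) → (Pos t → ℕ) → Set
IsRRGraceful t f =
  (∀ p q → f p ≡ f q → p ≡ q) ×
  (∀ p q → NonRoot p → NonRoot q → weight f p ≡ weight f q → p ≡ q)

module Submission where

-- Number the vertices of level L_j from left to right by their position
-- 0 ≤ i < |L_j|.  Even levels are labelled from the bottom and odd levels
-- from the top of the range: the vertex at position i of level j gets
--   base j + i            if j is even,
--   top ∸ (base j + i)    if j is odd,          where top = m + ex(T),
-- and the offsets satisfy base 0 = base 1 = 0, base (j+2) = base j + |L_j| + ex_{j+2}.
-- An edge between position u of L_{j+1} and position π of L_j then has weight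
--   top ∸ (Σ_{k<j} (|L_k| + ex_{k+2}) + u + π).
-- Labels are distinct because the even and the odd labels occupy disjoint
-- ranges (Σ_k |L_k| = m + 1 and Σ_k ex_k = ex(T) leave exactly enough room).
-- Weights are distinct because along a level parents' positions are monotone
-- (edges do not cross), and between consecutive levels the reserved gap
-- ex_{j+2} absorbs the vertices of L_{j+1} lying to the right of the parent of
-- the leftmost vertex of L_{j+2}; that last fact is the key excess lemma and is where the
-- left-layered ordering is used.

open import Defs
open import Data.Nat using (ℕ; zero; suc; _+_; _∸_; _≤_; _<_; _<ᵇ_; z≤n; s≤s; ∣_-_∣)
open import Data.Nat.Properties
open import Data.Nat.Tactic.RingSolver using (solve-∀)
open import Data.Fin using (Fin; toℕ)
import Data.Fin as F
import Data.Fin.Properties as FP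
open import Data.List using (List; []; _∷_; length; lookup; map; _++_; concat; tabulate; applyUpTo)
import Data.List.Properties as LP
open import Data.Nat.ListAction using (sum)
open import Data.Maybe using (Maybe; just; nothing; maybe′)
open import Data.Bool using (Bool; true; false; if_then_else_; not; T)
open import Data.Product using (Σ; _×_; _,_; proj₁; proj₂)
open import Data.Sum using (_⊎_; inj₁; inj₂)
open import Data.Empty using (⊥; ⊥-elim)
open import Data.Unit using (tt)
open import Relation.Nullary using (yes; no)
open import Relation.Binary using (tri<; tri≈; tri>)
open import Relation.Binary.PropositionalEquality

data At {A : Set} : List A → ℕ → A → Set where
  here  : ∀ {x xs} → At (x ∷ xs) 0 x
  there : ∀ {x xs i y} → At xs i y → At (x ∷ xs) (suc i) y

at-unique : ∀ {A} {xs : List A} {i y z} → At xs i y → At xs i z → y ≡ z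
at-unique here      here      = refl
at-unique (there a) (there b) = at-unique a b

at-bound : ∀ {A} {xs : List A} {i y} → At xs i y → i < length xs
at-bound here      = s≤s z≤n
at-bound (there a) = s≤s (at-bound a)

at-map : ∀ {A B : Set} (f : A → B) {xs i x} → At xs i x → At (map f xs) i (f x)
at-map f here      = here
at-map f (there a) = there (at-map f a)

at-map⁻ : ∀ {A B : Set} (f : A → B) (xs : List A) {i y} → At (map f xs) i y →
  Σ A λ x → (y ≡ f x) × At xs i x
at-map⁻ f (x ∷ xs) here = x , refl , here
at-map⁻ f (x ∷ xs) (there a) with at-map⁻ f xs a
... | z , e , b = z , e , there b

at-++ˡ : ∀ {A} {xs ys : List A} {i y} → At xs i y → At (xs ++ ys) i y
at-++ˡ here      = here
at-++ˡ (there a) = there (at-++ˡ a)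

at-++ʳ : ∀ {A} (xs : List A) {ys i y} → At ys i y → At (xs ++ ys) (length xs + i) y
at-++ʳ []       a = a
at-++ʳ (x ∷ xs) a = there (at-++ʳ xs a)

at-++⁻ : ∀ {A} (xs : List A) {ys : List A} {k y} → At (xs ++ ys) k y →
  At xs k y ⊎ Σ ℕ λ j → (k ≡ length xs + j) × At ys j y
at-++⁻ []       a = inj₂ (_ , refl , a)
at-++⁻ (x ∷ xs) here = inj₁ here
at-++⁻ (x ∷ xs) (there a) with at-++⁻ xs a
... | inj₁ b           = inj₁ (there b)
... | inj₂ (j , e , b) = inj₂ (j , cong suc e , b)

concatFin : ∀ {A : Set} (n : ℕ) → (Fin n → List A) → List A
concatFin zero    g = []
concatFin (suc n) g = g F.zero ++ concatFin n (λ i → g (F.suc i))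

offset : ∀ {A : Set} (n : ℕ) → (Fin n → List A) → Fin n → ℕ
offset (suc n) g F.zero    = 0
offset (suc n) g (F.suc i) = length (g F.zero) + offset n (λ i → g (F.suc i)) i

concat-map-tabulate : ∀ {A B : Set} (n : ℕ) (g : B → List A) (h : Fin n → B) →
  concat (map g (tabulate h)) ≡ concatFin n (λ i → g (h i))
concat-map-tabulate zero    g h = refl
concat-map-tabulate (suc n) g h =
  cong (g (h F.zero) ++_) (concat-map-tabulate n g (λ i → h (F.suc i)))

at-concatFin : ∀ {A : Set} (n : ℕ) (g : Fin n → List A) (i : Fin n) {j y} →
  At (g i) j y → At (concatFin n g) (offset n g i + j) y
at-concatFin (suc n) g F.zero    a = at-++ˡ a
at-concatFin (suc n) g (F.suc i) {j} {y} a =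
  subst (λ k → At (concatFin (suc n) g) k y) (sym (+-assoc (length (g F.zero)) _ j))
    (at-++ʳ (g F.zero) (at-concatFin n (λ i → g (F.suc i)) i a))

at-concatFin⁻ : ∀ {A : Set} (n : ℕ) (g : Fin n → List A) {k y} →
  At (concatFin n g) k y → Σ (Fin n) λ i → Σ ℕ λ j → (k ≡ offset n g i + j) × At (g i) j y
at-concatFin⁻ (suc n) g a with at-++⁻ (g F.zero) a
... | inj₁ b = F.zero , _ , refl , b
... | inj₂ (j , e , b) with at-concatFin⁻ n (λ i → g (F.suc i)) b
... | i , j′ , e′ , c =
  F.suc i , j′ , trans e (trans (cong (length (g F.zero) +_) e′) (sym (+-assoc (length (g F.zero)) _ j′))) , c

offset-mono : ∀ {A : Set} (n : ℕ) (g : Fin n → List A) (i i′ : Fin n) → toℕ i < toℕ i′ →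
  offset n g i + length (g i) ≤ offset n g i′
offset-mono (suc n) g F.zero    (F.suc i′) lt = m≤m+n _ _
offset-mono (suc n) g (F.suc i) (F.suc i′) (s≤s lt) =
  subst (_≤ length (g F.zero) + offset n (λ i → g (F.suc i)) i′)
    (sym (+-assoc (length (g F.zero)) _ _))
    (+-monoʳ-≤ (length (g F.zero)) (offset-mono n (λ i → g (F.suc i)) i i′ lt))

offset-lt : ∀ {A : Set} (n : ℕ) (g : Fin n → List A) (i i′ : Fin n) {a} b →
  toℕ i < toℕ i′ → a < length (g i) → offset n g i + a < offset n g i′ + b
offset-lt n g i i′ b lt a< =
  ≤-trans (+-monoʳ-< (offset n g i) a<) (≤-trans (offset-mono n g i i′ lt) (m≤m+n _ b))

offset-last : ∀ {A : Set} (n : ℕ) (g : Fin n → List A) (i : Fin n) →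
  (∀ (i′ : Fin n) → toℕ i < toℕ i′ → ⊥) → offset n g i + length (g i) ≡ length (concatFin n g)
offset-last (suc zero)    g F.zero h = sym (trans (LP.length-++ (g F.zero)) (+-identityʳ _))
offset-last (suc (suc n)) g F.zero h = ⊥-elim (h (F.suc F.zero) (s≤s z≤n))
offset-last (suc n) g (F.suc i) h =
  trans (+-assoc (length (g F.zero)) _ _)
   (trans (cong (length (g F.zero) +_)
            (offset-last n (λ i → g (F.suc i)) i (λ i′ lt → h (F.suc i′) (s≤s lt))))
     (sym (LP.length-++ (g F.zero))))

block : (ts : List Tree) → ℕ → Fin (length ts) → List (Pos (node ts))
block ts k i = map (child i) (level (lookup ts i) k)

level-suc : ∀ ts k → level (node ts) (suc k) ≡ concatFin (length ts) (block ts k)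
level-suc ts k = concat-map-tabulate (length ts) (block ts k) (λ i → i)

position : ∀ {t} → Pos t → ℕ
position root = 0
position {node ts} (child i p) = offset (length ts) (block ts (depth p)) i + position p

width : Tree → ℕ → ℕ
width t k = length (level t k)

at-level : ∀ {t} (p : Pos t) → At (level t (depth p)) (position p) p
at-level {node ts} root = here
at-level {node ts} (child i p) =
  subst (λ L → At L (position (child {ts} i p)) (child i p)) (sym (level-suc ts (depth p)))
    (at-concatFin (length ts) (block ts (depth p)) i (at-map (child {ts} i) (at-level p)))

at-level⁻ : ∀ {t} k {i q} → At (level t k) i q → (depth q ≡ k) × (position q ≡ i)
at-level⁻ {node ts} zero here = refl , refl
at-level⁻ {node ts} (suc k) {i} {q} a
  with at-concatFin⁻ (length ts) (block ts k) (subst (λ L → At L i q) (level-suc ts k) a)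
... | i₀ , j , e , b with at-map⁻ (child {ts} i₀) (level (lookup ts i₀) k) b
... | q′ , refl , c with at-level⁻ k c
... | refl , refl = refl , sym e

position-injective : ∀ {t} (p q : Pos t) → depth p ≡ depth q → position p ≡ position q → p ≡ q
position-injective {t} p q d e =
  at-unique (at-level p) (subst₂ (λ k i → At (level t k) i q) (sym d) (sym e) (at-level q))

position<width : ∀ {t} (p : Pos t) → position p < width t (depth p)
position<width p = at-bound (at-level p)

root-or-nonRoot : ∀ {s} (p : Pos s) → (depth p ≡ 0) ⊎ NonRoot p
root-or-nonRoot root        = inj₁ refl
root-or-nonRoot (child i p) = inj₂ tt

nonRoot : ∀ {t} (p : Pos t) {k} → depth p ≡ suc k → NonRoot p
nonRoot root ()
nonRoot (child i p) _ = tt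

parentM-root : ∀ {s} (p : Pos s) → depth p ≡ 0 → parentM p ≡ nothing
parentM-root root _ = refl

parentM-nonRoot : ∀ {s} (p : Pos s) → NonRoot p → parentM p ≡ just (parent p)
parentM-nonRoot (child i p) _ = refl

parent-child : ∀ {ts} (i : Fin (length ts)) (p : Pos (lookup ts i)) → NonRoot p →
  parent (child {ts} i p) ≡ child i (parent p)
parent-child {ts} i p np = cong (maybe′ (child {ts} i) root) (parentM-nonRoot p np)

parent-child-root : ∀ {ts} (i : Fin (length ts)) (p : Pos (lookup ts i)) → depth p ≡ 0 →
  parent (child {ts} i p) ≡ root
parent-child-root {ts} i p d = cong (maybe′ (child {ts} i) root) (parentM-root p d)

depth-parent : ∀ {t} (p : Pos t) → NonRoot p → suc (depth (parent p)) ≡ depth p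
depth-parent (child i p) _ with root-or-nonRoot p
... | inj₁ d  = trans (cong (λ x → suc (depth x)) (parent-child-root i p d)) (cong suc (sym d))
... | inj₂ np = trans (cong (λ x → suc (depth x)) (parent-child i p np)) (cong suc (depth-parent p np))

depth-parent′ : ∀ {t} (p : Pos t) {k} → depth p ≡ suc k → depth (parent p) ≡ k
depth-parent′ p d = suc-injective (trans (depth-parent p (nonRoot p d)) d)

close⇒siblings : ∀ {t} (x y : Pos t) → depth x ≡ depth y → dist x y ≤ 2 → parent x ≡ parent y
close⇒siblings root root _ _ = refl
close⇒siblings (child i p) (child j q) d le with root-or-nonRoot p | root-or-nonRoot q
... | inj₁ dp | inj₁ dq = trans (parent-child-root i p dp) (sym (parent-child-root j q dq))
... | inj₁ dp | inj₂ nq = ⊥-elim (0≢1+n (trans (sym dp) (trans (suc-injective d) (sym (depth-parent q nq)))))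
... | inj₂ np | inj₁ dq = ⊥-elim (0≢1+n (trans (sym dq) (trans (sym (suc-injective d)) (sym (depth-parent p np)))))
... | inj₂ np | inj₂ nq with i F.≟ j
...   | yes refl = trans (parent-child i p np)
                     (trans (cong (child i) (close⇒siblings p q (suc-injective d) le))
                       (sym (parent-child i q nq)))
...   | no _ = ⊥-elim (1+n≰n (≤-trans (+-mono-≤ (s≤s (subst (1 ≤_) (depth-parent p np) (s≤s z≤n)))
                                                  (s≤s (z≤n {depth q}))) le))

height-child : ∀ ts (i : Fin (length ts)) → suc (height (lookup ts i)) ≤ heights ts
height-child (t ∷ ts) F.zero    = m≤m⊔n (suc (height t)) (heights ts)
height-child (t ∷ ts) (F.suc i) = m≤n⇒m≤o⊔n (suc (height t)) (height-child ts i)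

depth≤height : ∀ {t} (p : Pos t) → depth p ≤ height t
depth≤height root = z≤n
depth≤height {node ts} (child i p) = ≤-trans (s≤s (depth≤height p)) (height-child ts i)

tallTree : ∀ ts k → suc k ≤ heights ts → Σ (Fin (length ts)) λ i → k ≤ height (lookup ts i)
tallTree (t ∷ ts) k le with ⊔-sel (suc (height t)) (heights ts)
... | inj₁ e = F.zero , ≤-pred (subst (suc k ≤_) e le)
... | inj₂ e with tallTree ts k (subst (suc k ≤_) e le)
...   | i , l = F.suc i , l

vertexAtDepth : ∀ t k → k ≤ height t → Σ (Pos t) λ q → depth q ≡ k
vertexAtDepth (node ts) zero    le = root , refl
vertexAtDepth (node ts) (suc k) le with tallTree ts k le
... | i , l with vertexAtDepth (lookup ts i) k l
...   | q , d = child i q , cong suc d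

level-empty : ∀ t k → height t < k → level t k ≡ []
level-empty t k lt with level t k in eq
... | [] = refl
... | x ∷ xs = ⊥-elim (<⇒≱ lt
       (subst (_≤ height t) (proj₁ (at-level⁻ k (subst (λ L → At L 0 x) (sym eq) here))) (depth≤height x)))

position<block : ∀ ts (i : Fin (length ts)) (p : Pos (lookup ts i)) →
  position p < length (block ts (depth p) i)
position<block ts i p =
  subst (position p <_) (sym (LP.length-map (child {ts} i) (level (lookup ts i) (depth p)))) (position<width p)

parent-monotone : ∀ {t} (p q : Pos t) → depth p ≡ depth q → position p ≤ position q →
  position (parent p) ≤ position (parent q)
parent-monotone root root _ _ = ≤-refl
parent-monotone {node ts} (child i p) (child i′ q) d le with root-or-nonRoot p | root-or-nonRoot q
... | inj₁ dp | inj₁ dq =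
  ≤-reflexive (cong position (trans (parent-child-root i p dp) (sym (parent-child-root i′ q dq))))
... | inj₁ dp | inj₂ nq = ⊥-elim (0≢1+n (trans (sym dp) (trans (suc-injective d) (sym (depth-parent q nq)))))
... | inj₂ np | inj₁ dq = ⊥-elim (0≢1+n (trans (sym dq) (trans (sym (suc-injective d)) (sym (depth-parent p np)))))
... | inj₂ np | inj₂ nq =
  subst₂ (λ a b → position a ≤ position b) (sym (parent-child i p np)) (sym (parent-child i′ q nq))
    (subst (λ k → offset n (block ts k′) i + position (parent p) ≤ offset n (block ts k) i′ + position (parent q))
      (sym same-parent-depth) compare-blocks)
  where
  n = length ts
  k k′ : ℕ
  k  = depth p
  k′ = depth (parent p)
  same-depth : depth q ≡ k
  same-depth = sym (suc-injective d)
  same-parent-depth : depth (parent q) ≡ k′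
  same-parent-depth = suc-injective (trans (depth-parent q nq) (trans same-depth (sym (depth-parent p np))))
  le′ : offset n (block ts k) i + position p ≤ offset n (block ts k) i′ + position q
  le′ = subst (λ m → offset n (block ts k) i + position p ≤ offset n (block ts m) i′ + position q) same-depth le
  compare-blocks : offset n (block ts k′) i + position (parent p) ≤ offset n (block ts k′) i′ + position (parent q)
  compare-blocks with <-cmp (toℕ i) (toℕ i′)
  ... | tri< lt _ _ = <⇒≤ (offset-lt n (block ts k′) i i′ _ lt (position<block ts i (parent p)))
  ... | tri≈ _ e _ with FP.toℕ-injective e
  ...   | refl = +-monoʳ-≤ (offset n (block ts k′) i)
                   (parent-monotone p q (sym same-depth) (+-cancelˡ-≤ (offset n (block ts k) i) _ _ le′))
  compare-blocks | tri> _ _ gt =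
    ⊥-elim (<⇒≱ (offset-lt n (block ts k) i′ i _ gt
                    (subst (λ m → position q < length (block ts m i′)) same-depth (position<block ts i′ q))) le′)

-- within a level, a vertex is determined by the sum of its position and its
-- parent's position: moving right increases the first and does not decrease the second
edge-determined : ∀ {t} (p q : Pos t) → depth p ≡ depth q →
  position p + position (parent p) ≡ position q + position (parent q) → p ≡ q
edge-determined p q sameDepth sameSum with <-cmp (position p) (position q)
... | tri≈ _ e _  = position-injective p q sameDepth e
... | tri< lt _ _ = ⊥-elim (<-irrefl sameSum (+-mono-<-≤ lt (parent-monotone p q sameDepth (<⇒≤ lt))))
... | tri> _ _ gt = ⊥-elim (<-irrefl (sym sameSum) (+-mono-<-≤ gt (parent-monotone q p (sym sameDepth) (<⇒≤ gt))))

child-index-injective : ∀ {ts} {i j : Fin (length ts)} {a : Pos (lookup ts i)} {b : Pos (lookup ts j)} →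
  child {ts} i a ≡ child j b → i ≡ j
child-index-injective refl = refl

child-injective : ∀ {ts} {i : Fin (length ts)} {a b : Pos (lookup ts i)} →
  child {ts} i a ≡ child i b → a ≡ b
child-injective refl = refl

-- In an ordered tree, if all vertices of level k+1 are children of one vertex,
-- that vertex is the rightmost one of level k: a sibling to its right would be
-- at least as high (condition (2)) and so would have children on level k+1 too.
lastParent : ∀ {t} → Ordered t → ∀ k (x : Pos t) → depth x ≡ suc k →
  (∀ q → depth q ≡ suc k → parent q ≡ parent x) → suc (position (parent x)) ≡ width t k
lastParent (node _ _) zero (child i p) d _ = cong (λ z → suc (position z)) (parent-child-root i p (suc-injective d))
lastParent {node ts} (node siblingOK ordered) (suc k) (child i p) d allSiblings = begin
  suc (position (parent (child {ts} i p)))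
    ≡⟨ cong (λ z → suc (position z)) (parent-child i p np) ⟩
  suc (offset n (block ts (depth (parent p))) i + position (parent p))
    ≡⟨ sym (+-suc _ (position (parent p))) ⟩
  offset n (block ts (depth (parent p))) i + suc (position (parent p))
    ≡⟨ cong (λ m → offset n (block ts m) i + suc (position (parent p))) (depth-parent′ p dp) ⟩
  offset n (block ts k) i + suc (position (parent p))
    ≡⟨ cong (offset n (block ts k) i +_) (trans inSubtree (sym (LP.length-map (child {ts} i) (level (lookup ts i) k)))) ⟩
  offset n (block ts k) i + length (block ts k i)
    ≡⟨ offset-last n (block ts k) i noSiblingToTheRight ⟩
  length (concatFin n (block ts k))
    ≡⟨ cong length (sym (level-suc ts k)) ⟩
  width (node ts) (suc k) ∎
  where
  open ≡-Reasoning
  n = length ts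
  dp : depth p ≡ suc k
  dp = suc-injective d
  np = nonRoot p dp
  inSubtree : suc (position (parent p)) ≡ width (lookup ts i) k
  inSubtree = lastParent (ordered i) k p dp λ q dq →
    child-injective (trans (sym (parent-child i q (nonRoot q dq)))
                      (trans (allSiblings (child i q) (cong suc dq)) (parent-child i p np)))
  noSiblingToTheRight : ∀ (i′ : Fin n) → toℕ i < toℕ i′ → ⊥
  noSiblingToTheRight i′ lt
    with vertexAtDepth (lookup ts i′) (suc k)
           (≤-trans (subst (_≤ _) dp (depth≤height p)) (≮⇒≥ (proj₁ (siblingOK i i′ lt))))
  ... | q , dq with child-index-injective (trans (sym (parent-child i′ q (nonRoot q dq)))
                     (trans (allSiblings (child i′ q) (cong suc dq)) (parent-child i p np)))
  ...   | refl = <-irrefl refl lt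

path-injective : ∀ {t} (p q : Pos t) → path p ≡ path q → p ≡ q
path-injective root root e = refl
path-injective (child i p) (child j q) e with FP.toℕ-injective (LP.∷-injectiveˡ e)
... | refl = cong (child i) (path-injective p q (LP.∷-injectiveʳ e))

samePos-sound : ∀ {t} (p q : Pos t) → samePos p q ≡ true → p ≡ q
samePos-sound p q e with LP.≡-dec Data.Nat._≟_ (path p) (path q)
... | yes pq = path-injective p q pq

samePos-refl : ∀ {t} (p : Pos t) → samePos p p ≡ true
samePos-refl p with LP.≡-dec Data.Nat._≟_ (path p) (path p)
... | yes _ = refl
... | no ¬e = ⊥-elim (¬e refl)

countRight-at : ∀ {t} (u : Pos t) L i → At L i u → (∀ k w → At L k w → w ≡ u → k ≡ i) →
  countRight u L ≡ length L ∸ suc i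
countRight-at u (w ∷ L) i a unique with samePos u w in eq
countRight-at u (w ∷ L) zero    a         unique | true = refl
countRight-at u (w ∷ L) (suc i) a         unique | true
  with () ← unique 0 w here (sym (samePos-sound u w eq))
countRight-at u (w ∷ L) zero    here      unique | false
  with () ← trans (sym (samePos-refl u)) eq
countRight-at u (w ∷ L) (suc i) (there a) unique | false =
  countRight-at u L i a (λ k w′ a′ e → suc-injective (unique (suc k) w′ (there a′) e))

AllAtDepth : ∀ {t} → List (Pos t) → ℕ → Set
AllAtDepth L k = ∀ i y → At L i y → depth y ≡ k

no-bad-pair : ∀ m → (2 <ᵇ m) ≡ false → m ≤ 2
no-bad-pair m e = ≮⇒≥ λ lt → subst T e (<⇒<ᵇ lt)

firstBad-just : ∀ {t} k (x : Pos t) L v → AllAtDepth (x ∷ L) k → firstBad (x ∷ L) ≡ just v →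
  parent v ≡ parent x
firstBad-just k x (y ∷ L) v all e with 2 <ᵇ dist x y in eq
... | true with refl ← e = refl
... | false = trans (firstBad-just k y L v (λ i z a → all (suc i) z (there a)) e)
                (sym (close⇒siblings x y (trans (all 0 x here) (sym (all 1 y (there here)))) (no-bad-pair _ eq)))

firstBad-nothing : ∀ {t} k (x : Pos t) L → AllAtDepth (x ∷ L) k → firstBad (x ∷ L) ≡ nothing →
  ∀ i y → At (x ∷ L) i y → parent y ≡ parent x
firstBad-nothing k x L all e .0 .x here = refl
firstBad-nothing k x (y ∷ L) all e (suc i) z (there a) with 2 <ᵇ dist x y in eq
... | false =
  trans (firstBad-nothing k y L (λ i z a → all (suc i) z (there a)) e i z a)
    (sym (close⇒siblings x y (trans (all 0 x here) (sym (all 1 y (there here)))) (no-bad-pair _ eq)))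

level-nonempty : ∀ {t} (q : Pos t) → Σ (Pos t) λ x → Σ (List (Pos t)) λ xs → level t (depth q) ≡ x ∷ xs
level-nonempty {t} q with level t (depth q) in eq | at-level q
... | x ∷ xs | _ = x , xs , refl

-- The excess lemma: the vertices of L_{j+1} to the right of the parent of the
-- leftmost vertex x of L_{j+2} number at most ex_{j+2}.  If L_{j+2} has a
-- non-sibling pair this is the definition of ex_{j+2}; otherwise that parent
-- is the rightmost vertex of L_{j+1}.
excess-leftmost : ∀ {t} → Ordered t → ∀ j (x : Pos t) xs → level t (suc (suc j)) ≡ x ∷ xs →
  width t (suc j) ≤ exLevel t (suc (suc j)) + suc (position (parent x))
excess-leftmost {t} ord j x xs eL =
  subst (λ L → width t (suc j) ≤ maybe′ countFrom 0 (firstBad L) + suc π) (sym eL) (byFirstBad _ refl)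
  where
  π = position (parent x)
  countFrom : Pos t → ℕ
  countFrom v = countRight (parent v) (level t (suc j))
  inLevel : ∀ {i y} → At (x ∷ xs) i y → At (level t (suc (suc j))) i y
  inLevel {i} {y} = subst (λ L → At L i y) (sym eL)
  all : AllAtDepth (x ∷ xs) (suc (suc j))
  all i y a = proj₁ (at-level⁻ (suc (suc j)) (inLevel a))
  parentAt : At (level t (suc j)) π (parent x)
  parentAt = subst (λ k → At (level t k) π (parent x)) (depth-parent′ x (all 0 x here)) (at-level (parent x))
  byFirstBad : (m : Maybe (Pos t)) → firstBad (x ∷ xs) ≡ m → width t (suc j) ≤ maybe′ countFrom 0 m + suc π
  byFirstBad (just v) e rewrite firstBad-just (suc (suc j)) x xs v all e
    | countRight-at (parent x) (level t (suc j)) π parentAt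
        (λ k w a w≡ → trans (sym (proj₂ (at-level⁻ (suc j) a))) (cong position w≡)) =
    subst (width t (suc j) ≤_) (+-comm (suc π) _) (m≤n+m∸n (width t (suc j)) (suc π))
  byFirstBad nothing e = ≤-reflexive (sym (lastParent ord (suc j) x (all 0 x here) siblings))
    where
    siblings : ∀ q → depth q ≡ suc (suc j) → parent q ≡ parent x
    siblings q dq = firstBad-nothing (suc (suc j)) x xs all e (position q) q
      (subst (λ L → At L (position q) q) eL (subst (λ k → At (level t k) (position q) q) dq (at-level q)))

-- the excess lemma for an arbitrary vertex q of L_{j+2}, using non-crossing edges
excess-bound : ∀ {t} → Ordered t → ∀ j (q : Pos t) → depth q ≡ suc (suc j) →
  width t (suc j) ≤ exLevel t (suc (suc j)) + suc (position (parent q))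
excess-bound {t} ord j q dq with level-nonempty q
... | x , xs , eL = ≤-trans (excess-leftmost ord j x xs (trans (cong (level t) (sym dq)) eL))
                      (+-monoʳ-≤ _ (s≤s (parent-monotone x q (proj₁ leftmost) (subst (_≤ position q) (sym (proj₂ leftmost)) z≤n))))
  where
  leftmost : (depth x ≡ depth q) × (position x ≡ 0)
  leftmost = at-level⁻ (depth q) (subst (λ L → At L 0 x) (sym eL) here)

sumBelow : ℕ → (ℕ → ℕ) → ℕ
sumBelow zero    f = 0
sumBelow (suc N) f = sumBelow N f + f N

sumBelow-front : ∀ N f → sumBelow (suc N) f ≡ f 0 + sumBelow N (λ k → f (suc k))
sumBelow-front zero    f = +-comm 0 (f 0)
sumBelow-front (suc N) f = trans (cong (_+ f (suc N)) (sumBelow-front N f)) (+-assoc (f 0) _ _)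

sumBelow-cong : ∀ N {f g} → (∀ k → f k ≡ g k) → sumBelow N f ≡ sumBelow N g
sumBelow-cong zero    h = refl
sumBelow-cong (suc N) h = cong₂ _+_ (sumBelow-cong N h) (h N)

sumBelow-+ : ∀ N f g → sumBelow N (λ k → f k + g k) ≡ sumBelow N f + sumBelow N g
sumBelow-+ zero    f g = refl
sumBelow-+ (suc N) f g =
  trans (cong (_+ (f N + g N)) (sumBelow-+ N f g)) (interchange (sumBelow N f) (sumBelow N g) (f N) (g N))
  where
  interchange : ∀ a b c d → a + b + (c + d) ≡ a + c + (b + d)
  interchange = solve-∀

sumBelow-zero : ∀ N → sumBelow N (λ _ → 0) ≡ 0
sumBelow-zero zero    = refl
sumBelow-zero (suc N) = trans (+-identityʳ _) (sumBelow-zero N)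

sumBelow-mono : ∀ {M N} f → M ≤ N → sumBelow M f ≤ sumBelow N f
sumBelow-mono {N = zero}  f z≤n = ≤-refl
sumBelow-mono {N = suc N} f le with m≤n⇒m<n∨m≡n le
... | inj₂ refl = ≤-refl
... | inj₁ lt   = ≤-trans (sumBelow-mono f (≤-pred lt)) (m≤m+n _ _)

sum-applyUpTo : ∀ n (f : ℕ → ℕ) g → sum (map f (applyUpTo g n)) ≡ sumBelow n (λ k → f (g k))
sum-applyUpTo zero    f g = refl
sum-applyUpTo (suc n) f g =
  trans (cong (f (g 0) +_) (sum-applyUpTo n f (λ k → g (suc k)))) (sym (sumBelow-front n (λ k → f (g k))))

excess≡sumBelow : ∀ t d → excess t d ≡ sumBelow (suc d) (exLevel t)
excess≡sumBelow t d = sum-applyUpTo (suc d) (exLevel t) (λ k → k)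

widthForest : List Tree → ℕ → ℕ
widthForest []       k = 0
widthForest (t ∷ ts) k = width t k + widthForest ts k

length-blocks : ∀ {B : Set} ts k (c : (i : Fin (length ts)) → Pos (lookup ts i) → B) →
  length (concatFin (length ts) (λ i → map (c i) (level (lookup ts i) k))) ≡ widthForest ts k
length-blocks []       k c = refl
length-blocks (t ∷ ts) k c = trans (LP.length-++ (map (c F.zero) (level t k)))
  (cong₂ _+_ (LP.length-map (c F.zero) (level t k)) (length-blocks ts k (λ i → c (F.suc i))))

width-suc : ∀ ts k → width (node ts) (suc k) ≡ widthForest ts k
width-suc ts k = trans (cong length (level-suc ts k)) (length-blocks ts k child)

-- the levels are disjoint, so together they contain at most m + 1 vertices
mutual
  sum-widths : ∀ t N → sumBelow N (width t) ≤ suc (numEdges t)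
  sum-widths (node ts) zero    = z≤n
  sum-widths (node ts) (suc N) =
    subst (_≤ suc (numEdgesL ts)) (sym (sumBelow-front N (width (node ts))))
      (s≤s (subst (_≤ numEdgesL ts) (sym (sumBelow-cong N (width-suc ts))) (sum-widthsForest ts N)))

  sum-widthsForest : ∀ ts N → sumBelow N (widthForest ts) ≤ numEdgesL ts
  sum-widthsForest []       N = ≤-reflexive (sumBelow-zero N)
  sum-widthsForest (t ∷ ts) N =
    subst (_≤ numEdgesL (t ∷ ts)) (sym (sumBelow-+ N (width t) (widthForest ts)))
      (+-mono-≤ (sum-widths t N) (sum-widthsForest ts N))

exLevel-beyond : ∀ t k → height t < k → exLevel t k ≡ 0
exLevel-beyond t k lt rewrite level-empty t k lt = refl

excess-tail : ∀ t d → height t ≡ d → ∀ b → b ≤ d →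
  sumBelow (suc b) (λ k → exLevel t (suc (suc k))) ≤ excess t d
excess-tail t d hd b le = begin
  sumBelow (suc b) (λ k → ex (suc (suc k)))
    ≤⟨ m≤n+m _ (ex 0 + ex 1) ⟩
  ex 0 + ex 1 + sumBelow (suc b) (λ k → ex (suc (suc k)))
    ≡⟨ sym dropFirstTwo ⟩
  sumBelow (suc (suc (suc b))) ex
    ≤⟨ sumBelow-mono ex (s≤s (s≤s (s≤s le))) ⟩
  sumBelow (suc d) ex + ex (suc d) + ex (suc (suc d))
    ≡⟨ cong₂ (λ a b → sumBelow (suc d) ex + a + b)
         (exLevel-beyond t (suc d) (s≤s (≤-reflexive hd)))
         (exLevel-beyond t (suc (suc d)) (s≤s (≤-trans (≤-reflexive hd) (n≤1+n d)))) ⟩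
  sumBelow (suc d) ex + 0 + 0
    ≡⟨ trans (+-identityʳ _) (trans (+-identityʳ _) (sym (excess≡sumBelow t d))) ⟩
  excess t d ∎
  where
  open ≤-Reasoning
  ex = exLevel t
  dropFirstTwo : sumBelow (suc (suc (suc b))) ex ≡ ex 0 + ex 1 + sumBelow (suc b) (λ k → ex (suc (suc k)))
  dropFirstTwo = trans (sumBelow-front (suc (suc b)) ex)
                   (trans (cong (ex 0 +_) (sumBelow-front (suc b) (λ k → ex (suc k))))
                     (sym (+-assoc (ex 0) (ex 1) _)))

isEven : ℕ → Bool
isEven zero          = true
isEven (suc zero)    = false
isEven (suc (suc n)) = isEven n

isEven-suc : ∀ n → isEven (suc n) ≡ not (isEven n)
isEven-suc zero          = refl
isEven-suc (suc zero)    = refl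
isEven-suc (suc (suc n)) = isEven-suc n

not-no-fixpoint : ∀ b → not b ≢ b
not-no-fixpoint true  ()
not-no-fixpoint false ()

not-involutive : ∀ b → not (not b) ≡ b
not-involutive true  = refl
not-involutive false = refl

same-parity-gap : ∀ a b → a < b → isEven a ≡ isEven b → suc (suc a) ≤ b
same-parity-gap a (suc b) (s≤s le) e with m≤n⇒m<n∨m≡n le
... | inj₁ lt   = s≤s lt
... | inj₂ refl = ⊥-elim (not-no-fixpoint (isEven a) (trans (sym (isEven-suc a)) (sym e)))

opposite-parity : ∀ a b → isEven a ≡ not (isEven b) → isEven b ≡ not (isEven a)
opposite-parity a b e = trans (sym (not-involutive (isEven b))) (cong not (sym e))

distance-to-top : ∀ top a b → a + b ≤ top → ∣ (top ∸ b) - a ∣ ≡ top ∸ (a + b)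
distance-to-top top a b le = begin
  ∣ (top ∸ b) - a ∣ ≡⟨ m≤n⇒∣n-m∣≡n∸m (m+n≤o⇒m≤o∸n a le) ⟩
  top ∸ b ∸ a       ≡⟨ ∸-+-assoc top b a ⟩
  top ∸ (b + a)     ≡⟨ cong (top ∸_) (+-comm b a) ⟩
  top ∸ (a + b)     ∎
  where open ≡-Reasoning

bottom<top : ∀ top a b → a + b < top → a < top ∸ b
bottom<top top a b lt = m+n≤o⇒m≤o∸n (suc a) lt

module Labelling (t : Tree) (d : ℕ) (ord : Ordered t) (hd : height t ≡ d) where

  ex : ℕ → ℕ
  ex = exLevel t

  reserve : ℕ → ℕ
  reserve j = width t j + ex (suc (suc j))

  -- the smallest code of level j; each parity class is filled level by level
  base : ℕ → ℕ
  base zero          = 0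
  base (suc zero)    = 0
  base (suc (suc j)) = base j + reserve j

  code : ℕ → ℕ → ℕ
  code j u = base j + u

  top : ℕ
  top = numEdges t + excess t d

  base-pair : ∀ j → base j + base (suc j) ≡ sumBelow j reserve
  base-pair zero    = refl
  base-pair (suc j) = trans (swap (base (suc j)) (base j) (reserve j)) (cong (_+ reserve j) (base-pair j))
    where
    swap : ∀ a b c → a + (b + c) ≡ b + a + c
    swap = solve-∀

  -- all reserves up to level d fit into the range: Σ |L_k| ≤ m + 1, Σ ex_{k+2} ≤ ex(T)
  reserves-fit : ∀ b → b ≤ d → sumBelow (suc b) reserve ≤ suc top
  reserves-fit b le = subst (_≤ suc top) (sym (sumBelow-+ (suc b) (width t) (λ k → ex (suc (suc k)))))
    (+-mono-≤ (sum-widths t (suc b)) (excess-tail t d hd b le))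

  base-mono : ∀ x y → isEven x ≡ isEven y → x ≤ y → base x ≤ base y
  base-mono x y e le with m≤n⇒m<n∨m≡n le
  ... | inj₂ refl = ≤-refl
  ... | inj₁ lt with same-parity-gap x y lt e
  ...   | s≤s (s≤s le′) = ≤-trans (base-mono x _ e le′) (m≤m+n _ _)

  code<next-base : ∀ a u → u < width t a → code a u < base (suc (suc a))
  code<next-base a u lt = +-monoʳ-< (base a) (≤-trans lt (m≤m+n (width t a) _))

  code≤top : ∀ a u → a ≤ d → u < width t a → code a u ≤ top
  code≤top a u ad lt = ≤-pred (begin
    suc (code a u)                     ≤⟨ code<next-base a u lt ⟩
    base (suc (suc a))                 ≤⟨ m≤n+m _ (base (suc a)) ⟩
    base (suc a) + base (suc (suc a))  ≡⟨ base-pair (suc a) ⟩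
    sumBelow (suc a) reserve           ≤⟨ reserves-fit a ad ⟩
    suc top                            ∎)
    where open ≤-Reasoning

  code-injective : ∀ a b u v → isEven a ≡ isEven b → code a u ≡ code b v →
    u < width t a → v < width t b → (a ≡ b) × (u ≡ v)
  code-injective a b u v e eq ua vb with <-cmp a b
  ... | tri≈ _ refl _ = refl , +-cancelˡ-≡ (base a) u v eq
  ... | tri< lt _ _ = ⊥-elim (<-irrefl eq (≤-trans (code<next-base a u ua)
                        (≤-trans (base-mono _ _ e (same-parity-gap a b lt e)) (m≤m+n (base b) v))))
  ... | tri> _ _ gt = ⊥-elim (<-irrefl (sym eq) (≤-trans (code<next-base b v vb)
                        (≤-trans (base-mono _ _ (sym e) (same-parity-gap b a gt (sym e))) (m≤m+n (base a) u))))

  separated-< : ∀ a b u v → a < b → isEven a ≡ not (isEven b) → b ≤ d →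
    u < width t a → v < width t b → code a u + code b v < top
  separated-< a b u v lt e bd ua vb = ≤-pred (begin
    suc (suc (code a u + code b v))  ≡⟨ cong suc (sym (+-suc (code a u) (code b v))) ⟩
    suc (code a u) + suc (code b v)  ≤⟨ +-mono-≤ belowOddBase (code<next-base b v vb) ⟩
    base (suc b) + base (suc (suc b)) ≡⟨ base-pair (suc b) ⟩
    sumBelow (suc b) reserve          ≤⟨ reserves-fit b bd ⟩
    suc top                           ∎)
    where
    open ≤-Reasoning
    belowOddBase : code a u < base (suc b)
    belowOddBase = ≤-trans (code<next-base a u ua)
                     (base-mono (suc (suc a)) (suc b) (trans e (sym (isEven-suc b))) (s≤s lt))

  separated : ∀ a b u v → isEven a ≡ not (isEven b) → a ≤ d → b ≤ d →
    u < width t a → v < width t b → code a u + code b v < top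
  separated a b u v e ad bd ua vb with <-cmp a b
  ... | tri< lt _ _ = separated-< a b u v lt e bd ua vb
  ... | tri≈ _ refl _ = ⊥-elim (not-no-fixpoint (isEven b) (sym e))
  ... | tri> _ _ gt = subst (_< top) (+-comm (code b v) (code a u))
                        (separated-< b a v u gt (opposite-parity a b e) ad vb ua)

  label : ℕ → ℕ → ℕ
  label j u = if isEven j then code j u else top ∸ code j u

  f : Pos t → ℕ
  f p = label (depth p) (position p)

  depth≤d : ∀ (p : Pos t) → depth p ≤ d
  depth≤d p = subst (depth p ≤_) hd (depth≤height p)

  codeOf≤top : ∀ (p : Pos t) → code (depth p) (position p) ≤ top
  codeOf≤top p = code≤top (depth p) (position p) (depth≤d p) (position<width p)

  f≤top : ∀ (p : Pos t) → f p ≤ top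
  f≤top p with isEven (depth p)
  ... | true  = codeOf≤top p
  ... | false = m∸n≤m top (code (depth p) (position p))

  even<odd : ∀ (p q : Pos t) → isEven (depth p) ≡ not (isEven (depth q)) →
    code (depth p) (position p) < top ∸ code (depth q) (position q)
  even<odd p q e = bottom<top top _ _
    (separated (depth p) (depth q) (position p) (position q) e (depth≤d p) (depth≤d q)
      (position<width p) (position<width q))

  same-code : ∀ (p q : Pos t) → isEven (depth p) ≡ isEven (depth q) →
    code (depth p) (position p) ≡ code (depth q) (position q) → p ≡ q
  same-code p q e eq with code-injective (depth p) (depth q) (position p) (position q) e eq
                            (position<width p) (position<width q)
  ... | sameDepth , samePosition = position-injective p q sameDepth samePosition

  f-injective : ∀ (p q : Pos t) → f p ≡ f q → p ≡ q
  f-injective p q eq with isEven (depth p) in ep | isEven (depth q) in eq′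
  ... | true  | true  = same-code p q (trans ep (sym eq′)) eq
  ... | false | false = same-code p q (trans ep (sym eq′)) (∸-cancelˡ-≡ (codeOf≤top p) (codeOf≤top q) eq)
  ... | true  | false = ⊥-elim (<-irrefl eq (even<odd p q (trans ep (cong not (sym eq′)))))
  ... | false | true  = ⊥-elim (<-irrefl (sym eq) (even<odd q p (trans eq′ (cong not (sym ep)))))

  -- the key of the edge from p up to its parent; its weight is top ∸ key
  edgeKey : Pos t → ℕ
  edgeKey p = sumBelow (depth (parent p)) reserve + (position p + position (parent p))

  edgeKey≡codes : ∀ (p : Pos t) →
    code (depth (parent p)) (position (parent p)) + code (suc (depth (parent p))) (position p) ≡ edgeKey p
  edgeKey≡codes p = trans (regroup (base j) (base (suc j)) (position (parent p)) (position p))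
                      (cong (_+ (position p + position (parent p))) (base-pair j))
    where
    j = depth (parent p)
    regroup : ∀ a b π u → a + π + (b + u) ≡ a + b + (u + π)
    regroup = solve-∀

  -- the two endpoints of an edge lie on levels of opposite parity
  edgeKey<top : ∀ (p : Pos t) → NonRoot p → edgeKey p < top
  edgeKey<top p np = subst (_< top) (edgeKey≡codes p)
    (separated j (suc j) (position (parent p)) (position p) parity (depth≤d (parent p))
      (subst (_≤ d) (sym (depth-parent p np)) (depth≤d p))
      (position<width (parent p))
      (subst (λ k → position p < width t k) (sym (depth-parent p np)) (position<width p)))
    where
    j = depth (parent p)
    parity : isEven j ≡ not (isEven (suc j))
    parity = trans (sym (not-involutive (isEven j))) (cong not (sym (isEven-suc j)))

  labels-across : ∀ j u π → code j π + code (suc j) u ≤ top →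
    ∣ label (suc j) u - label j π ∣ ≡ top ∸ (code j π + code (suc j) u)
  labels-across j u π le rewrite isEven-suc j with isEven j
  ... | true  = distance-to-top top (code j π) (code (suc j) u) le
  ... | false = begin
    ∣ code (suc j) u - (top ∸ code j π) ∣ ≡⟨ ∣-∣-comm (code (suc j) u) (top ∸ code j π) ⟩
    ∣ (top ∸ code j π) - code (suc j) u ∣ ≡⟨ distance-to-top top (code (suc j) u) (code j π)
                                                (subst (_≤ top) (+-comm (code j π) (code (suc j) u)) le) ⟩
    top ∸ (code (suc j) u + code j π)     ≡⟨ cong (top ∸_) (+-comm (code (suc j) u) (code j π)) ⟩
    top ∸ (code j π + code (suc j) u)     ∎
    where open ≡-Reasoning

  weight≡ : ∀ (p : Pos t) → NonRoot p → weight f p ≡ top ∸ edgeKey p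
  weight≡ p np = begin
    ∣ label (depth p) u - label j π ∣     ≡⟨ cong (λ k → ∣ label k u - label j π ∣) (sym (depth-parent p np)) ⟩
    ∣ label (suc j) u - label j π ∣       ≡⟨ labels-across j u π (subst (_≤ top) (sym (edgeKey≡codes p))
                                                                   (<⇒≤ (edgeKey<top p np))) ⟩
    top ∸ (code j π + code (suc j) u)     ≡⟨ cong (top ∸_) (edgeKey≡codes p) ⟩
    top ∸ edgeKey p                       ∎
    where
    open ≡-Reasoning
    j = depth (parent p)
    u = position p
    π = position (parent p)

  edgeKey-< : ∀ (p q : Pos t) → NonRoot p → NonRoot q → depth (parent p) < depth (parent q) →
    edgeKey p < edgeKey q
  edgeKey-< p q np nq lt with m≤n⇒m<n∨m≡n lt
  ... | inj₁ lt₂ = begin-strict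
    sumBelow j reserve + (u + π)                                 <⟨ +-monoʳ-< (sumBelow j reserve) (+-mono-<-≤ u<width (<⇒≤ π<width)) ⟩
    sumBelow j reserve + (width t (suc j) + width t j)             ≤⟨ +-monoʳ-≤ (sumBelow j reserve)
                                                                       (+-mono-≤ (m≤m+n (width t (suc j)) _) (m≤m+n (width t j) _)) ⟩
    sumBelow j reserve + (reserve (suc j) + reserve j)            ≡⟨ swap (sumBelow j reserve) (reserve j) (reserve (suc j)) ⟩
    sumBelow (suc (suc j)) reserve                                ≤⟨ sumBelow-mono reserve lt₂ ⟩
    sumBelow (depth (parent q)) reserve                           ≤⟨ m≤m+n _ _ ⟩
    edgeKey q                                                     ∎
    where
    open ≤-Reasoning
    j = depth (parent p)
    u = position p
    π = position (parent p)
    u<width : u < width t (suc j)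
    u<width = subst (λ k → u < width t k) (sym (depth-parent p np)) (position<width p)
    π<width : π < width t j
    π<width = position<width (parent p)
    swap : ∀ s a b → s + (b + a) ≡ s + a + b
    swap = solve-∀
  ... | inj₂ nextLevel = subst (λ k → edgeKey p < sumBelow k reserve + (u′ + π′)) nextLevel (begin-strict
    sumBelow j reserve + (u + π)                         <⟨ +-monoʳ-< (sumBelow j reserve) (+-mono-≤-< u≤ π<width) ⟩
    sumBelow j reserve + ((ex (suc (suc j)) + π′) + width t j)
                                                         ≤⟨ +-monoʳ-≤ (sumBelow j reserve) (rearrange (m≤n+m π′ u′)) ⟩
    sumBelow j reserve + (reserve j + (u′ + π′))          ≡⟨ sym (+-assoc (sumBelow j reserve) _ _) ⟩
    sumBelow (suc j) reserve + (u′ + π′)                  ∎)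
    where
    open ≤-Reasoning
    j = depth (parent p)
    u = position p
    π = position (parent p)
    u′ = position q
    π′ = position (parent q)
    π<width : π < width t j
    π<width = position<width (parent p)
    -- the excess lemma, applied to q on level j+2
    u≤ : u ≤ ex (suc (suc j)) + π′
    u≤ = ≤-pred (subst (suc u ≤_) (+-suc _ π′)
           (≤-trans (subst (λ k → u < width t k) (sym (depth-parent p np)) (position<width p))
             (excess-bound ord j q (trans (sym (depth-parent q nq)) (cong suc (sym nextLevel))))))
    rearrange : π′ ≤ u′ + π′ → ex (suc (suc j)) + π′ + width t j ≤ reserve j + (u′ + π′)
    rearrange le = subst (_≤ reserve j + (u′ + π′)) (shuffle (width t j) (ex (suc (suc j))) π′)
                     (+-monoʳ-≤ (reserve j) le)
      where
      shuffle : ∀ w e π′ → w + e + π′ ≡ e + π′ + w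
      shuffle = solve-∀

  edgeKey-injective : ∀ (p q : Pos t) → NonRoot p → NonRoot q → edgeKey p ≡ edgeKey q → p ≡ q
  edgeKey-injective p q np nq eq with <-cmp (depth (parent p)) (depth (parent q))
  ... | tri< lt _ _ = ⊥-elim (<-irrefl eq (edgeKey-< p q np nq lt))
  ... | tri> _ _ gt = ⊥-elim (<-irrefl (sym eq) (edgeKey-< q p nq np gt))
  ... | tri≈ _ sameParentDepth _ = edge-determined p q sameDepth sameSum
    where
    sameDepth : depth p ≡ depth q
    sameDepth = trans (sym (depth-parent p np)) (trans (cong suc sameParentDepth) (depth-parent q nq))
    sameSum : position p + position (parent p) ≡ position q + position (parent q)
    sameSum = +-cancelˡ-≡ (sumBelow (depth (parent p)) reserve) _ _
      (trans eq (cong (λ k → sumBelow k reserve + (position q + position (parent q))) (sym sameParentDepth)))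

  weight-injective : ∀ (p q : Pos t) → NonRoot p → NonRoot q → weight f p ≡ weight f q → p ≡ q
  weight-injective p q np nq eq = edgeKey-injective p q np nq
    (∸-cancelˡ-≡ (<⇒≤ (edgeKey<top p np)) (<⇒≤ (edgeKey<top q nq))
      (trans (sym (weight≡ p np)) (trans eq (weight≡ q nq))))

mainTheorem1 : (t : Tree) (d : ℕ) → LeftLayered t d →
    Σ (Pos t → ℕ) (λ f → IsRRGraceful t f × (∀ p → f p ≤ numEdges t + excess t d))
mainTheorem1 t d (_ , _ , heightIsDiameter , ordered) =
  f , (f-injective , weight-injective) , f≤top
  where open Labelling t d ordered heightIsDiameter
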